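{- Let $\prec$ be a transitive relation on $\mathbb{N}$, let $\mathcal{B}$ and $\prec_V$ be as in the context, and let $I \subseteq \mathcal{B}$ be an ideal with respect to $\prec_V$. If $r \in I$ and $A \subseteq dom(r)$, then $r|_A \in I$, where $r|_A$ is the partial function obtained by restricting the domain of $r$ to $A$.
   Context: For a transitive relation $R$ on a countable set $S$, a subset $I \subseteq S$ is an ideal (with respect to $R$) if (1) $I \neq \emptyset$; (2) for all $a \in I$ and $b \in S$, $b R a$ implies $b \in I$; (3) for all $a,b\in I$ there is $c \in I$ with $a R c$ and $b R c$. Let $\prec$ be a transitive relation on $\mathbb{N}$. Let $\mathcal{B}$ be the countable set of all partial functions $r :\subseteq \mathbb{N} \to \mathbb{Q}_{>0}$ with finite domain $dom(r)$, where $\mathbb{Q}_{>0}$ is the set of rationals strictly greater than $0$. Define the relation $\prec_V$ on $\mathcal{B}$ by: $r \prec_V s$ iff $\sum_{b\in F} r(b) < \sum_{c \in {\uparrow}F \cap dom(s)} s(c)$ for every non-empty $F \subseteq dom(r)$, where ${\uparrow}F = \{c \in \mathbb{N} \mid \exists b \in F,\ b \prec c\}$. (This relation is transitive.) -}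

module Defs where

open import Level using (0ℓ)
open import Data.Nat as ℕ using (ℕ)
open import Data.Rational as ℚ using (ℚ; 0ℚ; _+_; _<_; Positive)
open import Data.Product using (_×_; _,_; proj₁; proj₂; Σ; ∃; ∃-syntax)
open import Data.List using (List; []; _∷_; foldr; map)
open import Data.List.Relation.Unary.All using (All; []; _∷_)
open import Data.List.Relation.Unary.AllPairs using (AllPairs; []; _∷_)
open import Data.List.Membership.Propositional using (_∈_)
open import Data.List.Relation.Binary.Sublist.Propositional using (_⊆_; []; _∷_; _∷ʳ_)
open import Data.List.Relation.Binary.Sublist.Propositional.Properties using (All-resp-⊆)
open import Relation.Binary.PropositionalEquality using (_≡_; refl)
open import Relation.Nullary using (¬_)
open import Function.Bundles using (_⇔_)

Entry : Set
Entry = ℕ × ℚ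

KeyLt : Entry → Entry → Set
KeyLt e e' = proj₁ e ℕ.< proj₁ e'

PosVal : Entry → Set
PosVal e = Positive (proj₂ e)

-- 𝓑 : finite partial functions ℕ ⇀ ℚ_{>0}, represented canonically as the
-- graph listed in strictly increasing order of arguments.  Proof fields are
-- irrelevant, so two elements are equal iff they are the same partial function.
record 𝓑 : Set where
  constructor mk𝓑
  field
    graph   : List Entry
    .sorted : AllPairs KeyLt graph
    .pos    : All PosVal graph
open 𝓑 public

AllPairs-resp-⊆ : ∀ {R : Entry → Entry → Set} {xs ys : List Entry} →
                  xs ⊆ ys → AllPairs R ys → AllPairs R xs
AllPairs-resp-⊆ []          []         = []
AllPairs-resp-⊆ (y ∷ʳ p)    (_ ∷ ps)   = AllPairs-resp-⊆ p ps
AllPairs-resp-⊆ (refl ∷ p)  (a ∷ ps)   = All-resp-⊆ p a ∷ AllPairs-resp-⊆ p ps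

-- Restriction r|_A, where A ⊆ dom(r) is given as a sub-graph of r
-- (subsets of dom r correspond exactly to sublists of the sorted graph).
restrict : (r : 𝓑) (A : List Entry) → A ⊆ graph r → 𝓑
restrict (mk𝓑 g s q) A p = mk𝓑 A (AllPairs-resp-⊆ p s) (All-resp-⊆ p q)

Σval : List Entry → ℚ
Σval = foldr (λ e acc → proj₂ e + acc) 0ℚ

Up : (ℕ → ℕ → Set) → List Entry → ℕ → Set
Up _≺_ F c = ∃[ e ] (e ∈ F × proj₁ e ≺ c)

-- r ≺_V s : for every non-empty F ⊆ dom r,
--   Σ_{b∈F} r(b) < Σ_{c ∈ ↑F ∩ dom s} s(c).
-- The set ↑F ∩ dom s is given by the sub-graph G of s whose members are
-- exactly the entries of s with argument in ↑F.
_≺V_[_] : 𝓑 → 𝓑 → (ℕ → ℕ → Set) → Set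
r ≺V s [ _≺_ ] =
  (F : List Entry) → F ⊆ graph r → ¬ (F ≡ []) →
  (G : List Entry) → G ⊆ graph s →
  (∀ e → e ∈ graph s → (e ∈ G ⇔ Up _≺_ F (proj₁ e))) →
  Σval F < Σval G

Transitive : (ℕ → ℕ → Set) → Set
Transitive _≺_ = ∀ {a b c} → a ≺ b → b ≺ c → a ≺ c

record IsIdeal (R : 𝓑 → 𝓑 → Set) (I : 𝓑 → Set) : Set where
  field
    nonempty : ∃[ a ] I a
    downward : ∀ a b → I a → R b a → I b
    directed : ∀ a b → I a → I b → ∃[ c ] (I c × R a c × R b c)

module Submission where

open import Defs
open import Data.List using (List)
open import Data.Nat using (ℕ)
open import Data.List.Relation.Binary.Sublist.Propositional using (_⊆_; ⊆-trans)
open import Data.Product using (∃-syntax; _×_; _,_)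

-- Directedness applied to r and r itself yields some c ∈ I strictly above r.
-- Every non-empty F ⊆ A is also a non-empty subset of dom r, so r|_A ≺_V c
-- holds by the very inequalities witnessing r ≺_V c; downward closure
-- then puts r|_A in I.

restrict-≺V : ∀ {_≺_ : ℕ → ℕ → Set} {r s : 𝓑} (A : List Entry) (A⊆r : A ⊆ graph r) →
              r ≺V s [ _≺_ ] → restrict r A A⊆r ≺V s [ _≺_ ]
restrict-≺V A A⊆r r≺s F F⊆A = r≺s F (⊆-trans F⊆A A⊆r)

module _ {R : 𝓑 → 𝓑 → Set} {I : 𝓑 → Set} (isIdeal : IsIdeal R I) where
  open IsIdeal isIdeal

  ideal-unbounded : ∀ {r} → I r → ∃[ c ] (I c × R r c)
  ideal-unbounded {r} Ir with directed r r Ir Ir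
  ... | c , Ic , r<c , _ = c , Ic , r<c

lemma5 : (_≺_ : ℕ → ℕ → Set) → Transitive _≺_ →
         (I : 𝓑 → Set) → IsIdeal (λ r s → r ≺V s [ _≺_ ]) I →
         (r : 𝓑) → I r → (A : List Entry) (A⊆r : A ⊆ graph r) →
         I (restrict r A A⊆r)
lemma5 _≺_ _ I isIdeal r Ir A A⊆r with ideal-unbounded isIdeal Ir
... | c , Ic , r≺c =
  IsIdeal.downward isIdeal c (restrict r A A⊆r) Ic (restrict-≺V {_≺_} {r} {c} A A⊆r r≺c)
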